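{- For any odd prime $p$, there exists an MRS$^*_{\mathbb{Z}_p\oplus\mathbb{Z}_8\oplus\mathbb{Z}_8}(p,4;16)$.
   Context: $\mathbb{Z}_v$ denotes the additive group of integers modulo $v$. For a finite abelian group $(G,+)$ of order $xyz$, an MRS$^*_G(x,y;z)$ is a collection of $z$ arrays of size $x\times y$ whose entries are elements of $G$, each element of $G$ appearing exactly once among all the arrays, such that every row sum and every column sum in every array equals $0$. -}

module Defs where

open import Data.Nat as ℕ using (ℕ; NonZero)
open import Data.Nat.DivMod using (_mod_)
open import Data.Fin using (Fin; toℕ)
open import Data.Product using (_×_; _,_; Σ)
open import Function.Definitions using (Bijective)
open import Relation.Binary.PropositionalEquality using (_≡_)

_+ₙ_ : {n : ℕ} .{{_ : NonZero n}} → Fin n → Fin n → Fin n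
_+ₙ_ {n} a b = (toℕ a ℕ.+ toℕ b) mod n

G : (p : ℕ) → Set
G p = Fin p × Fin 8 × Fin 8

module _ (p : ℕ) .{{_ : NonZero p}} where

  zeroG : G p
  zeroG = (0 mod p , Data.Fin.zero , Data.Fin.zero)

  _⊕_ : G p → G p → G p
  (a , b , c) ⊕ (a' , b' , c') = (a +ₙ a' , b +ₙ b' , c +ₙ c')

  sumG : (m : ℕ) → (Fin m → G p) → G p
  sumG ℕ.zero f = zeroG
  sumG (ℕ.suc m) f = f Data.Fin.zero ⊕ sumG m (λ i → f (Data.Fin.suc i))

  -- MRS*_G(x,y;z): z arrays of size x × y with entries in G (|G| = xyz),
  -- every element of G appears exactly once (bijection from cell positions to G),
  -- every row sum and every column sum is 0.
  record MRS* (x y z : ℕ) : Set where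
    field
      A        : Fin z → Fin x → Fin y → G p
      once     : Bijective {A = Fin z × Fin x × Fin y} _≡_ _≡_
                   (λ { (k , i , j) → A k i j })
      rowSum   : ∀ k i → sumG y (λ j → A k i j) ≡ zeroG
      colSum   : ∀ k j → sumG x (λ i → A k i j) ≡ zeroG

{-# OPTIONS --safe #-}
module Submission where

open import Defs
open import Data.Nat as ℕ using (ℕ; NonZero; zero; suc; _*_; _∸_; _%_)
import Data.Nat.Properties as ℕ
open import Data.Nat.DivMod using (_mod_; _/_; m≡m%n+[m/n]*n; m<n⇒m%n≡m; n%n≡0)
open import Data.Empty using (⊥-elim)
open import Data.Nat.Primality using (Prime; ¬prime[1])
open import Data.Fin as Fin using (Fin; zero; suc; toℕ; #_; opposite)
open import Data.Fin.Properties using (toℕ-injective; toℕ-fromℕ<; toℕ<n; opposite-prop; opposite-involutive; all?; any?; _≟_)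
open import Data.Product using (_×_; _,_; proj₁; ∃; uncurry; map₂)
open import Data.Product.Properties using (≡-dec)
open import Data.Sign using (Sign; +; -)
open import Data.Vec using (Vec; _∷_; []; lookup)
open import Function using (_∘_)
open import Function.Definitions using (Bijective; StrictlySurjective)
open import Function.Bundles using (Inverse; mk⤖)
open import Function.Properties.Bijection using (⤖⇒↔)
open import Function.Consequences.Propositional
  using (strictlySurjective⇒surjective; surjective⇒strictlySurjective; inverseᵇ⇒bijective; strictlyInverseˡ⇒inverseˡ; strictlyInverseʳ⇒inverseʳ)
open import Relation.Binary.Definitions using (DecidableEquality)
open import Relation.Binary.PropositionalEquality using (_≡_; _≢_; refl; sym; trans; cong; cong₂; subst; module ≡-Reasoning)
open import Relation.Nullary.Decidable using (Dec; map′; _×-dec_; _→-dec_; toWitness)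
open import Relation.Unary using (Decidable)

-- Write p = 2n + 1 and label ℤ_p by 0 and ±(2t + 1), t < n.  In every array the
-- row labelled v has ℤ_p-entries v, −v, v, −v, which cancel along the row; down a
-- column they run through ℤ_p as 0 followed by pairs ±x, which cancel as well.
-- The ℤ₈²-entries of a row are read off one of five 16 × 4 tables, chosen by
-- whether its label is 0, ±1 or ±(2t + 1) with t ≥ 1.  It suffices that every
-- table row sums to 0, that the tables for 0, 1, −1 add up to 0 entrywise, that
-- the two remaining tables are entrywise opposite, and that the 64 cells with a
-- fixed ℤ_p-entry receive each element of ℤ₈² once; these are finite conditions,
-- verified by evaluation.

module _ {q : ℕ} where

  toℕ-+ₙ : (a b : Fin (suc q)) → toℕ (a +ₙ b) ≡ (toℕ a ℕ.+ toℕ b) % suc q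
  toℕ-+ₙ a b = toℕ-fromℕ< _

  +ₙ-identityˡ : (a : Fin (suc q)) → zero +ₙ a ≡ a
  +ₙ-identityˡ a = toℕ-injective (trans (toℕ-+ₙ zero a) (m<n⇒m%n≡m (toℕ<n a)))

  +ₙ-identityʳ : (a : Fin (suc q)) → a +ₙ zero ≡ a
  +ₙ-identityʳ a = toℕ-injective (begin
    toℕ (a +ₙ zero)        ≡⟨ toℕ-+ₙ a zero ⟩
    (toℕ a ℕ.+ 0) % suc q  ≡⟨ cong (_% suc q) (ℕ.+-identityʳ (toℕ a)) ⟩
    toℕ a % suc q          ≡⟨ m<n⇒m%n≡m (toℕ<n a) ⟩
    toℕ a                  ∎)
    where open ≡-Reasoning

  +ₙ-comm : (a b : Fin (suc q)) → a +ₙ b ≡ b +ₙ a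
  +ₙ-comm a b = cong (_mod suc q) (ℕ.+-comm (toℕ a) (toℕ b))

  +ₙ-inverse : (a b : Fin (suc q)) → toℕ a ℕ.+ toℕ b ≡ suc q → a +ₙ b ≡ zero
  +ₙ-inverse a b sum≡q = toℕ-injective (begin
    toℕ (a +ₙ b)                ≡⟨ toℕ-+ₙ a b ⟩
    (toℕ a ℕ.+ toℕ b) % suc q   ≡⟨ cong (_% suc q) sum≡q ⟩
    suc q % suc q               ≡⟨ n%n≡0 (suc q) ⟩
    0                           ∎)
    where open ≡-Reasoning

  +ₙ-cancel-pair : (a b : Fin (suc q)) → a +ₙ b ≡ zero → a +ₙ (b +ₙ zero) ≡ zero
  +ₙ-cancel-pair a b a+b≡0 = trans (cong (a +ₙ_) (+ₙ-identityʳ b)) a+b≡0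

  +ₙ-cancel-twice : (a b : Fin (suc q)) → a +ₙ b ≡ zero → a +ₙ (b +ₙ (a +ₙ (b +ₙ zero))) ≡ zero
  +ₙ-cancel-twice a b a+b≡0 = begin
    a +ₙ (b +ₙ (a +ₙ (b +ₙ zero)))  ≡⟨ cong (λ x → a +ₙ (b +ₙ x)) (+ₙ-cancel-pair a b a+b≡0) ⟩
    a +ₙ (b +ₙ zero)                ≡⟨ +ₙ-cancel-pair a b a+b≡0 ⟩
    zero                            ∎
    where open ≡-Reasoning

-- Recursive rather than 2 * n, so that Fin (double (suc n)) is Fin (suc (suc _))
-- definitionally.
double : ℕ → ℕ
double zero    = zero
double (suc n) = suc (suc (double n))

double-+ : ∀ m n → double (m ℕ.+ n) ≡ double m ℕ.+ double n
double-+ zero    n = refl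
double-+ (suc m) n = cong (2 ℕ.+_) (double-+ m n)

double≡n*2 : ∀ n → double n ≡ n * 2
double≡n*2 zero    = refl
double≡n*2 (suc n) = cong (2 ℕ.+_) (double≡n*2 n)

split : ∀ {n} → Fin (double n) → Sign × Fin n
split {suc n} zero          = + , zero
split {suc n} (suc zero)    = - , zero
split {suc n} (suc (suc i)) = map₂ suc (split i)

-- The suc clause comes first so that merge s (suc t) computes for a variable s.
merge : ∀ {n} → Sign → Fin n → Fin (double n)
merge s (suc t) = suc (suc (merge s t))
merge + zero    = zero
merge - zero    = suc zero

split-merge : ∀ {n} s (t : Fin n) → split (merge s t) ≡ (s , t)
split-merge s (suc t) = cong (map₂ suc) (split-merge s t)
split-merge + zero    = refl
split-merge - zero    = refl

merge-split : ∀ {n} (i : Fin (double n)) → uncurry merge (split i) ≡ i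
merge-split {suc n} zero          = refl
merge-split {suc n} (suc zero)    = refl
merge-split {suc n} (suc (suc i)) = cong (Fin.suc ∘ Fin.suc) (merge-split i)

toℕ-merge-+ : ∀ {n} (t : Fin n) → toℕ (merge + t) ≡ double (toℕ t)
toℕ-merge-+ zero    = refl
toℕ-merge-+ (suc t) = cong (2 ℕ.+_) (toℕ-merge-+ t)

toℕ-merge-- : ∀ {n} (t : Fin n) → toℕ (merge - t) ≡ suc (double (toℕ t))
toℕ-merge-- zero    = refl
toℕ-merge-- (suc t) = cong (2 ℕ.+_) (toℕ-merge-- t)

data Signed (n : ℕ) : Set where
  0ˢ  : Signed n
  _·_ : Sign → Fin n → Signed n

neg : ∀ {n} → Signed n → Signed n
neg 0ˢ      = 0ˢ
neg (+ · t) = - · t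
neg (- · t) = + · t

infixr 5 _◃_
_◃_ : ∀ {n} → Sign → Signed n → Signed n
+ ◃ v = v
- ◃ v = neg v

neg-involutive : ∀ {n} (v : Signed n) → neg (neg v) ≡ v
neg-involutive 0ˢ      = refl
neg-involutive (+ · t) = refl
neg-involutive (- · t) = refl

◃-involutive : ∀ {n} s (v : Signed n) → s ◃ s ◃ v ≡ v
◃-involutive + v = refl
◃-involutive - v = neg-involutive v

◃-neg : ∀ {n} s (v : Signed n) → s ◃ neg v ≡ neg (s ◃ v)
◃-neg + v = refl
◃-neg - v = refl

◃-0ˢ : ∀ {n} s → s ◃ 0ˢ ≡ 0ˢ {n}
◃-0ˢ + = refl
◃-0ˢ - = refl

-- The five elements of Signed 2 stand for the kinds of labels 0, ±1 and ±(2t + 1)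
-- with t ≥ 1.
collapse : ∀ {n} → Signed n → Signed 2
collapse 0ˢ          = 0ˢ
collapse (s · zero)  = s · zero
collapse (s · suc _) = s · suc zero

collapse-neg : ∀ {n} (v : Signed n) → collapse (neg v) ≡ neg (collapse v)
collapse-neg 0ˢ          = refl
collapse-neg (+ · zero)  = refl
collapse-neg (- · zero)  = refl
collapse-neg (+ · suc _) = refl
collapse-neg (- · suc _) = refl

collapse-◃ : ∀ {n} s (v : Signed n) → collapse (s ◃ v) ≡ s ◃ collapse v
collapse-◃ + v = refl
collapse-◃ - v = collapse-neg v

label : ∀ {n} → Fin (suc (double n)) → Signed n
label zero    = 0ˢ
label (suc i) = uncurry _·_ (split i)

index : ∀ {n} → Signed n → Fin (suc (double n))
index 0ˢ      = zero
index (s · t) = suc (merge s t)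

label-index : ∀ {n} (v : Signed n) → label (index v) ≡ v
label-index 0ˢ      = refl
label-index (s · t) = cong (uncurry _·_) (split-merge s t)

index-label : ∀ {n} (i : Fin (suc (double n))) → index (label i) ≡ i
index-label zero    = refl
index-label (suc i) = cong suc (merge-split i)

reflect : ∀ {n} → Signed n → Signed n
reflect 0ˢ      = 0ˢ
reflect (+ · t) = + · t
reflect (- · t) = - · opposite t

reflect-involutive : ∀ {n} (v : Signed n) → reflect (reflect v) ≡ v
reflect-involutive 0ˢ      = refl
reflect-involutive (+ · t) = refl
reflect-involutive (- · t) = cong (- ·_) (opposite-involutive t)

-- label lists 0ˢ, + · 0, - · 0, + · 1, - · 1, … , so opposite labels are adjacent;
-- reflecting the negative ones gives value (s · t) = s (2t + 1), whence
-- value (neg v) = − value v.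
value : ∀ {n} → Signed n → Fin (suc (double n))
value = index ∘ reflect

value⁻¹ : ∀ {n} → Fin (suc (double n)) → Signed n
value⁻¹ = reflect ∘ label

value-value⁻¹ : ∀ {n} (x : Fin (suc (double n))) → value (value⁻¹ x) ≡ x
value-value⁻¹ x = trans (cong index (reflect-involutive (label x))) (index-label x)

value⁻¹-value : ∀ {n} (v : Signed n) → value⁻¹ (value v) ≡ v
value⁻¹-value v = trans (cong reflect (label-index (reflect v))) (reflect-involutive v)

toℕ-value±-sum : ∀ {n} (t : Fin n) → toℕ (value (+ · t)) ℕ.+ toℕ (value (- · t)) ≡ suc (double n)
toℕ-value±-sum {n} t = begin
  suc (toℕ (merge + t)) ℕ.+ suc (toℕ (merge - (opposite t)))
    ≡⟨ cong₂ (λ x y → suc x ℕ.+ suc y) (toℕ-merge-+ t) (toℕ-merge-- (opposite t)) ⟩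
  suc (double a ℕ.+ double (suc b))
    ≡⟨ cong suc (sym (double-+ a (suc b))) ⟩
  suc (double (a ℕ.+ suc b))
    ≡⟨ cong (suc ∘ double) a+1+b≡n ⟩
  suc (double n) ∎
  where
  open ≡-Reasoning
  a b : ℕ
  a = toℕ t
  b = toℕ (opposite t)
  a+1+b≡n : a ℕ.+ suc b ≡ n
  a+1+b≡n = begin
    a ℕ.+ suc b            ≡⟨ ℕ.+-suc a b ⟩
    suc a ℕ.+ b            ≡⟨ cong (suc a ℕ.+_) (opposite-prop t) ⟩
    suc a ℕ.+ (n ∸ suc a)  ≡⟨ ℕ.m+[n∸m]≡n (toℕ<n t) ⟩
    n                      ∎

value-neg : ∀ {n} (v : Signed n) → value v +ₙ value (neg v) ≡ zero
value-neg 0ˢ      = refl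
value-neg (+ · t) = +ₙ-inverse (value (+ · t)) (value (- · t)) (toℕ-value±-sum t)
value-neg (- · t) = trans (+ₙ-comm (value (- · t)) (value (+ · t))) (value-neg (+ · t))

value-◃-neg : ∀ {n} s (v : Signed n) → value (s ◃ v) +ₙ value (s ◃ neg v) ≡ zero
value-◃-neg s v =
  subst (λ w → value (s ◃ v) +ₙ value w ≡ zero) (sym (◃-neg s v)) (value-neg (s ◃ v))

module _ {p : ℕ} .{{_ : NonZero p}} where

  infixr 6 _⊕ₚ_
  _⊕ₚ_ : G p → G p → G p
  _⊕ₚ_ = _⊕_ p

  sumG-pairwise-cancel : ∀ r (f : Sign × Fin r → G p) →
                         (∀ t → f (+ , t) ⊕ₚ f (- , t) ⊕ₚ zeroG p ≡ zeroG p) →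
                         sumG p (double r) (f ∘ split) ≡ zeroG p
  sumG-pairwise-cancel zero    f cancels = refl
  sumG-pairwise-cancel (suc r) f cancels = begin
    f (+ , zero) ⊕ₚ f (- , zero) ⊕ₚ sumG p (double r) (f ∘ map₂ suc ∘ split)
      ≡⟨ cong (λ x → f (+ , zero) ⊕ₚ f (- , zero) ⊕ₚ x)
              (sumG-pairwise-cancel r (f ∘ map₂ suc) (cancels ∘ suc)) ⟩
    f (+ , zero) ⊕ₚ f (- , zero) ⊕ₚ zeroG p
      ≡⟨ cancels zero ⟩
    zeroG p ∎
    where open ≡-Reasoning

ℤ₈² : Set
ℤ₈² = Fin 8 × Fin 8

infixr 6 _⊞_
_⊞_ : ℤ₈² → ℤ₈² → ℤ₈²
(a , b) ⊞ (a′ , b′) = (a +ₙ a′ , b +ₙ b′)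

0₈ : ℤ₈²
0₈ = zero , zero

columnSign : Fin 4 → Sign
columnSign zero                   = +
columnSign (suc zero)             = -
columnSign (suc (suc zero))       = +
columnSign (suc (suc (suc zero))) = -

Table : Set
Table = Signed 2 → Fin 16 → Fin 4 → ℤ₈²

-- The ℤ₈²-entries of the cells (k , j) whose ℤ_p-entry is a fixed w of kind c: in
-- column j such a cell lies in the row labelled columnSign j ◃ w.
fibre : Table → Signed 2 → Fin 16 × Fin 4 → ℤ₈²
fibre t c (k , j) = t (columnSign j ◃ c) k j

record IsTemplate (t : Table) : Set where
  field
    row-sum               : ∀ c k → t c k (# 0) ⊞ t c k (# 1) ⊞ t c k (# 2) ⊞ t c k (# 3) ⊞ 0₈ ≡ 0₈
    zero-and-units-cancel : ∀ k j → t 0ˢ k j ⊞ t (+ · zero) k j ⊞ t (- · zero) k j ⊞ 0₈ ≡ 0₈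
    opposites-cancel      : ∀ k j → t (+ · suc zero) k j ⊞ t (- · suc zero) k j ⊞ 0₈ ≡ 0₈
    fibre-bijective       : ∀ c → Bijective _≡_ _≡_ (fibre t c)

module Construction {t : Table} (T : IsTemplate t) (m : ℕ) where
  open IsTemplate T

  p : ℕ
  p = suc (double (suc m))

  entry : Fin 16 → Signed (suc m) → Fin 4 → G p
  entry k v j = value (columnSign j ◃ v) , t (collapse v) k j

  array : Fin 16 → Fin p → Fin 4 → G p
  array k i = entry k (label i)

  row-sums : ∀ k i → sumG p 4 (array k i) ≡ zeroG p
  row-sums k i =
    cong₂ _,_ (+ₙ-cancel-twice (value v) (value (neg v)) (value-neg v)) (row-sum (collapse v) k)
    where
    v : Signed (suc m)
    v = label i

  column-sums : ∀ k j → sumG p p (λ i → array k i j) ≡ zeroG p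
  column-sums k j = begin
    cell 0ˢ ⊕ₚ cell (+ · zero) ⊕ₚ cell (- · zero) ⊕ₚ sumG p (double m) (far ∘ split)
      ≡⟨ cong (λ x → cell 0ˢ ⊕ₚ cell (+ · zero) ⊕ₚ cell (- · zero) ⊕ₚ x)
              (sumG-pairwise-cancel m far far-cancels) ⟩
    cell 0ˢ ⊕ₚ cell (+ · zero) ⊕ₚ cell (- · zero) ⊕ₚ zeroG p
      ≡⟨ cong₂ _,_ near-cancels (zero-and-units-cancel k j) ⟩
    zeroG p ∎
    where
    open ≡-Reasoning
    s : Sign
    s = columnSign j
    cell : Signed (suc m) → G p
    cell v = entry k v j
    far : Sign × Fin m → G p
    far (s′ , u) = cell (s′ · suc u)
    far-cancels : ∀ u → far (+ , u) ⊕ₚ far (- , u) ⊕ₚ zeroG p ≡ zeroG p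
    far-cancels u =
      cong₂ _,_ (+ₙ-cancel-pair (value (s ◃ + · suc u)) (value (s ◃ - · suc u)) (value-◃-neg s (+ · suc u)))
                (opposites-cancel k j)
    near-cancels : proj₁ (cell 0ˢ ⊕ₚ cell (+ · zero) ⊕ₚ cell (- · zero) ⊕ₚ zeroG p) ≡ zero
    near-cancels = begin
      value (s ◃ 0ˢ) +ₙ (a +ₙ (b +ₙ zero))  ≡⟨ cong (λ w → value w +ₙ (a +ₙ (b +ₙ zero))) (◃-0ˢ s) ⟩
      zero +ₙ (a +ₙ (b +ₙ zero))            ≡⟨ +ₙ-identityˡ (a +ₙ (b +ₙ zero)) ⟩
      a +ₙ (b +ₙ zero)                      ≡⟨ +ₙ-cancel-pair a b (value-◃-neg s (+ · zero)) ⟩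
      zero                                  ∎
      where
      a b : Fin p
      a = value (s ◃ + · zero)
      b = value (s ◃ - · zero)

  module Fibre (c : Signed 2) = Inverse (⤖⇒↔ (mk⤖ (fibre-bijective c)))

  contents : Fin 16 × Fin p × Fin 4 → G p
  contents (k , i , j) = array k i j

  position-in-fibre : Signed (suc m) → Fin 16 × Fin 4 → Fin 16 × Fin p × Fin 4
  position-in-fibre w (k , j) = k , index (columnSign j ◃ w) , j

  position : G p → Fin 16 × Fin p × Fin 4
  position (x , h) = position-in-fibre w (Fibre.from (collapse w) h)
    where
    w : Signed (suc m)
    w = value⁻¹ x

  contents-in-fibre : ∀ w kj → contents (position-in-fibre w kj) ≡ (value w , fibre t (collapse w) kj)
  contents-in-fibre w (k , j) = begin
    value (s ◃ label (index (s ◃ w))) , t (collapse (label (index (s ◃ w)))) k j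
      ≡⟨ cong (λ v → value (s ◃ v) , t (collapse v) k j) (label-index (s ◃ w)) ⟩
    value (s ◃ s ◃ w) , t (collapse (s ◃ w)) k j
      ≡⟨ cong₂ _,_ (cong value (◃-involutive s w)) (cong (λ c → t c k j) (collapse-◃ s w)) ⟩
    value w , t (s ◃ collapse w) k j ∎
    where
    open ≡-Reasoning
    s : Sign
    s = columnSign j

  position-of-fibre : ∀ w kj → position (value w , fibre t (collapse w) kj) ≡ position-in-fibre w kj
  position-of-fibre w kj = begin
    position (value w , h)
      ≡⟨ cong (λ w′ → position-in-fibre w′ (Fibre.from (collapse w′) h)) (value⁻¹-value w) ⟩
    position-in-fibre w (Fibre.from (collapse w) h)
      ≡⟨ cong (position-in-fibre w) (Fibre.strictlyInverseʳ (collapse w) kj) ⟩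
    position-in-fibre w kj ∎
    where
    open ≡-Reasoning
    h : ℤ₈²
    h = fibre t (collapse w) kj

  contents-position : ∀ y → contents (position y) ≡ y
  contents-position (x , h) =
    trans (contents-in-fibre w kj) (cong₂ _,_ (value-value⁻¹ x) (Fibre.strictlyInverseˡ (collapse w) h))
    where
    w : Signed (suc m)
    w = value⁻¹ x
    kj : Fin 16 × Fin 4
    kj = Fibre.from (collapse w) h

  position-contents : ∀ z → position (contents z) ≡ z
  position-contents (k , i , j) = begin
    position (value (s ◃ v) , t (collapse v) k j)
      ≡⟨ cong (λ c → position (value (s ◃ v) , t c k j)) collapse-v ⟩
    position (value (s ◃ v) , fibre t (collapse (s ◃ v)) (k , j))
      ≡⟨ position-of-fibre (s ◃ v) (k , j) ⟩
    k , index (s ◃ s ◃ v) , j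
      ≡⟨ cong (λ u → k , index u , j) (◃-involutive s v) ⟩
    k , index (label i) , j
      ≡⟨ cong (λ x → k , x , j) (index-label i) ⟩
    k , i , j ∎
    where
    open ≡-Reasoning
    s : Sign
    s = columnSign j
    v : Signed (suc m)
    v = label i
    collapse-v : collapse v ≡ s ◃ collapse (s ◃ v)
    collapse-v = sym (trans (cong (s ◃_) (collapse-◃ s v)) (◃-involutive s (collapse v)))

  mrs : MRS* p p 4 16
  mrs = record
    { A      = array
    ; once   = inverseᵇ⇒bijective ( strictlyInverseˡ⇒inverseˡ contents contents-position
                                  , strictlyInverseʳ⇒inverseʳ contents position-contents)
    ; rowSum = row-sums
    ; colSum = column-sums
    }

module _ {m n : ℕ} where

  all-×? : {P : Fin m × Fin n → Set} → Decidable P → Dec (∀ x → P x)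
  all-×? P? = map′ (λ h (k , j) → h k j) (λ h k j → h (k , j)) (all? λ k → all? λ j → P? (k , j))

  any-×? : {P : Fin m × Fin n → Set} → Decidable P → Dec (∃ P)
  any-×? P? = map′ (λ (k , j , pkj) → (k , j) , pkj) (λ ((k , j) , pkj) → k , j , pkj)
                   (any? λ k → any? λ j → P? (k , j))

  ≟-× : DecidableEquality (Fin m × Fin n)
  ≟-× = ≡-dec _≟_ _≟_

bijective? : ∀ {m n a b} (f : Fin m × Fin n → Fin a × Fin b) → Dec (Bijective _≡_ _≡_ f)
bijective? f = map′ (λ (inj , surj) → (λ {x} {y} → inj x y) , strictlySurjective⇒surjective surj)
                    (λ (inj , surj) → (λ x y → inj) , surjective⇒strictlySurjective surj)
                    (injective? ×-dec strictlySurjective?)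
  where
  injective? : Dec (∀ x y → f x ≡ f y → x ≡ y)
  injective? = all-×? λ x → all-×? λ y → ≟-× (f x) (f y) →-dec ≟-× x y
  strictlySurjective? : Dec (StrictlySurjective _≡_ f)
  strictlySurjective? = all-×? λ y → any-×? λ x → ≟-× (f x) y

all-Signed? : ∀ {n} {P : Signed n → Set} → Decidable P → Dec (∀ v → P v)
all-Signed? {P = P} P? =
  map′ (λ h v → subst P (label-index v) (h (index v))) (λ h i → h (label i)) (all? (P? ∘ label))

tables : Signed 2 → Vec (Vec ℤ₈² 4) 16
tables 0ˢ =
  ((# 7 , # 6) ∷ (# 0 , # 6) ∷ (# 7 , # 5) ∷ (# 2 , # 7) ∷ []) ∷
  ((# 7 , # 1) ∷ (# 4 , # 7) ∷ (# 1 , # 7) ∷ (# 4 , # 1) ∷ []) ∷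
  ((# 2 , # 0) ∷ (# 4 , # 0) ∷ (# 1 , # 5) ∷ (# 1 , # 3) ∷ []) ∷
  ((# 6 , # 2) ∷ (# 5 , # 3) ∷ (# 3 , # 0) ∷ (# 2 , # 3) ∷ []) ∷
  ((# 0 , # 3) ∷ (# 7 , # 2) ∷ (# 3 , # 3) ∷ (# 6 , # 0) ∷ []) ∷
  ((# 6 , # 1) ∷ (# 3 , # 6) ∷ (# 5 , # 4) ∷ (# 2 , # 5) ∷ []) ∷
  ((# 7 , # 7) ∷ (# 5 , # 6) ∷ (# 3 , # 7) ∷ (# 1 , # 4) ∷ []) ∷
  ((# 0 , # 0) ∷ (# 0 , # 7) ∷ (# 3 , # 2) ∷ (# 5 , # 7) ∷ []) ∷
  ((# 7 , # 0) ∷ (# 6 , # 4) ∷ (# 5 , # 1) ∷ (# 6 , # 3) ∷ []) ∷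
  ((# 4 , # 5) ∷ (# 2 , # 1) ∷ (# 1 , # 0) ∷ (# 1 , # 2) ∷ []) ∷
  ((# 6 , # 5) ∷ (# 5 , # 0) ∷ (# 3 , # 1) ∷ (# 2 , # 2) ∷ []) ∷
  ((# 0 , # 2) ∷ (# 6 , # 7) ∷ (# 1 , # 6) ∷ (# 1 , # 1) ∷ []) ∷
  ((# 7 , # 3) ∷ (# 7 , # 4) ∷ (# 6 , # 6) ∷ (# 4 , # 3) ∷ []) ∷
  ((# 0 , # 4) ∷ (# 2 , # 6) ∷ (# 4 , # 2) ∷ (# 2 , # 4) ∷ []) ∷
  ((# 5 , # 2) ∷ (# 4 , # 6) ∷ (# 4 , # 4) ∷ (# 3 , # 4) ∷ []) ∷
  ((# 5 , # 5) ∷ (# 0 , # 5) ∷ (# 3 , # 5) ∷ (# 0 , # 1) ∷ []) ∷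
  []
tables (+ · zero) =
  ((# 2 , # 4) ∷ (# 7 , # 3) ∷ (# 6 , # 6) ∷ (# 1 , # 3) ∷ []) ∷
  ((# 7 , # 0) ∷ (# 7 , # 5) ∷ (# 2 , # 3) ∷ (# 0 , # 0) ∷ []) ∷
  ((# 1 , # 5) ∷ (# 1 , # 4) ∷ (# 7 , # 6) ∷ (# 7 , # 1) ∷ []) ∷
  ((# 1 , # 6) ∷ (# 6 , # 4) ∷ (# 7 , # 1) ∷ (# 2 , # 5) ∷ []) ∷
  ((# 2 , # 5) ∷ (# 6 , # 6) ∷ (# 5 , # 2) ∷ (# 3 , # 3) ∷ []) ∷
  ((# 6 , # 5) ∷ (# 2 , # 1) ∷ (# 0 , # 0) ∷ (# 0 , # 2) ∷ []) ∷
  ((# 4 , # 5) ∷ (# 4 , # 6) ∷ (# 5 , # 3) ∷ (# 3 , # 2) ∷ []) ∷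
  ((# 7 , # 3) ∷ (# 4 , # 3) ∷ (# 3 , # 2) ∷ (# 2 , # 0) ∷ []) ∷
  ((# 1 , # 4) ∷ (# 1 , # 2) ∷ (# 0 , # 1) ∷ (# 6 , # 1) ∷ []) ∷
  ((# 2 , # 1) ∷ (# 4 , # 7) ∷ (# 6 , # 7) ∷ (# 4 , # 1) ∷ []) ∷
  ((# 6 , # 3) ∷ (# 7 , # 7) ∷ (# 2 , # 7) ∷ (# 1 , # 7) ∷ []) ∷
  ((# 6 , # 0) ∷ (# 1 , # 6) ∷ (# 2 , # 2) ∷ (# 7 , # 0) ∷ []) ∷
  ((# 3 , # 3) ∷ (# 4 , # 4) ∷ (# 3 , # 6) ∷ (# 6 , # 3) ∷ []) ∷
  ((# 5 , # 5) ∷ (# 5 , # 2) ∷ (# 7 , # 7) ∷ (# 7 , # 2) ∷ []) ∷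
  ((# 3 , # 7) ∷ (# 4 , # 5) ∷ (# 4 , # 3) ∷ (# 5 , # 1) ∷ []) ∷
  ((# 0 , # 2) ∷ (# 6 , # 5) ∷ (# 0 , # 6) ∷ (# 2 , # 3) ∷ []) ∷
  []
tables (- · zero) =
  ((# 7 , # 6) ∷ (# 1 , # 7) ∷ (# 3 , # 5) ∷ (# 5 , # 6) ∷ []) ∷
  ((# 2 , # 7) ∷ (# 5 , # 4) ∷ (# 5 , # 6) ∷ (# 4 , # 7) ∷ []) ∷
  ((# 5 , # 3) ∷ (# 3 , # 4) ∷ (# 0 , # 5) ∷ (# 0 , # 4) ∷ []) ∷
  ((# 1 , # 0) ∷ (# 5 , # 1) ∷ (# 6 , # 7) ∷ (# 4 , # 0) ∷ []) ∷
  ((# 6 , # 0) ∷ (# 3 , # 0) ∷ (# 0 , # 3) ∷ (# 7 , # 5) ∷ []) ∷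
  ((# 4 , # 2) ∷ (# 3 , # 1) ∷ (# 3 , # 4) ∷ (# 6 , # 1) ∷ []) ∷
  ((# 5 , # 4) ∷ (# 7 , # 4) ∷ (# 0 , # 6) ∷ (# 4 , # 2) ∷ []) ∷
  ((# 1 , # 5) ∷ (# 4 , # 6) ∷ (# 2 , # 4) ∷ (# 1 , # 1) ∷ []) ∷
  ((# 0 , # 4) ∷ (# 1 , # 2) ∷ (# 3 , # 6) ∷ (# 4 , # 4) ∷ []) ∷
  ((# 2 , # 2) ∷ (# 2 , # 0) ∷ (# 1 , # 1) ∷ (# 3 , # 5) ∷ []) ∷
  ((# 4 , # 0) ∷ (# 4 , # 1) ∷ (# 3 , # 0) ∷ (# 5 , # 7) ∷ []) ∷
  ((# 2 , # 6) ∷ (# 1 , # 3) ∷ (# 5 , # 0) ∷ (# 0 , # 7) ∷ []) ∷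
  ((# 6 , # 2) ∷ (# 5 , # 0) ∷ (# 7 , # 4) ∷ (# 6 , # 2) ∷ []) ∷
  ((# 3 , # 7) ∷ (# 1 , # 0) ∷ (# 5 , # 7) ∷ (# 7 , # 2) ∷ []) ∷
  ((# 0 , # 7) ∷ (# 0 , # 5) ∷ (# 0 , # 1) ∷ (# 0 , # 3) ∷ []) ∷
  ((# 3 , # 1) ∷ (# 2 , # 6) ∷ (# 5 , # 5) ∷ (# 6 , # 4) ∷ []) ∷
  []
tables (+ · suc zero) =
  ((# 0 , # 0) ∷ (# 4 , # 0) ∷ (# 4 , # 4) ∷ (# 0 , # 4) ∷ []) ∷
  ((# 0 , # 1) ∷ (# 4 , # 7) ∷ (# 4 , # 5) ∷ (# 0 , # 3) ∷ []) ∷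
  ((# 0 , # 2) ∷ (# 4 , # 6) ∷ (# 4 , # 6) ∷ (# 0 , # 2) ∷ []) ∷
  ((# 0 , # 3) ∷ (# 4 , # 5) ∷ (# 4 , # 7) ∷ (# 0 , # 1) ∷ []) ∷
  ((# 1 , # 0) ∷ (# 3 , # 0) ∷ (# 5 , # 4) ∷ (# 7 , # 4) ∷ []) ∷
  ((# 1 , # 1) ∷ (# 3 , # 7) ∷ (# 5 , # 5) ∷ (# 7 , # 3) ∷ []) ∷
  ((# 1 , # 2) ∷ (# 3 , # 6) ∷ (# 5 , # 6) ∷ (# 7 , # 2) ∷ []) ∷
  ((# 1 , # 3) ∷ (# 3 , # 5) ∷ (# 5 , # 7) ∷ (# 7 , # 1) ∷ []) ∷
  ((# 2 , # 0) ∷ (# 2 , # 0) ∷ (# 6 , # 4) ∷ (# 6 , # 4) ∷ []) ∷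
  ((# 2 , # 1) ∷ (# 2 , # 7) ∷ (# 6 , # 5) ∷ (# 6 , # 3) ∷ []) ∷
  ((# 2 , # 2) ∷ (# 2 , # 6) ∷ (# 6 , # 6) ∷ (# 6 , # 2) ∷ []) ∷
  ((# 2 , # 3) ∷ (# 2 , # 5) ∷ (# 6 , # 7) ∷ (# 6 , # 1) ∷ []) ∷
  ((# 3 , # 0) ∷ (# 1 , # 0) ∷ (# 7 , # 4) ∷ (# 5 , # 4) ∷ []) ∷
  ((# 3 , # 1) ∷ (# 1 , # 7) ∷ (# 7 , # 5) ∷ (# 5 , # 3) ∷ []) ∷
  ((# 3 , # 2) ∷ (# 1 , # 6) ∷ (# 7 , # 6) ∷ (# 5 , # 2) ∷ []) ∷
  ((# 3 , # 3) ∷ (# 1 , # 5) ∷ (# 7 , # 7) ∷ (# 5 , # 1) ∷ []) ∷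
  []
tables (- · suc zero) =
  ((# 0 , # 0) ∷ (# 4 , # 0) ∷ (# 4 , # 4) ∷ (# 0 , # 4) ∷ []) ∷
  ((# 0 , # 7) ∷ (# 4 , # 1) ∷ (# 4 , # 3) ∷ (# 0 , # 5) ∷ []) ∷
  ((# 0 , # 6) ∷ (# 4 , # 2) ∷ (# 4 , # 2) ∷ (# 0 , # 6) ∷ []) ∷
  ((# 0 , # 5) ∷ (# 4 , # 3) ∷ (# 4 , # 1) ∷ (# 0 , # 7) ∷ []) ∷
  ((# 7 , # 0) ∷ (# 5 , # 0) ∷ (# 3 , # 4) ∷ (# 1 , # 4) ∷ []) ∷
  ((# 7 , # 7) ∷ (# 5 , # 1) ∷ (# 3 , # 3) ∷ (# 1 , # 5) ∷ []) ∷
  ((# 7 , # 6) ∷ (# 5 , # 2) ∷ (# 3 , # 2) ∷ (# 1 , # 6) ∷ []) ∷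
  ((# 7 , # 5) ∷ (# 5 , # 3) ∷ (# 3 , # 1) ∷ (# 1 , # 7) ∷ []) ∷
  ((# 6 , # 0) ∷ (# 6 , # 0) ∷ (# 2 , # 4) ∷ (# 2 , # 4) ∷ []) ∷
  ((# 6 , # 7) ∷ (# 6 , # 1) ∷ (# 2 , # 3) ∷ (# 2 , # 5) ∷ []) ∷
  ((# 6 , # 6) ∷ (# 6 , # 2) ∷ (# 2 , # 2) ∷ (# 2 , # 6) ∷ []) ∷
  ((# 6 , # 5) ∷ (# 6 , # 3) ∷ (# 2 , # 1) ∷ (# 2 , # 7) ∷ []) ∷
  ((# 5 , # 0) ∷ (# 7 , # 0) ∷ (# 1 , # 4) ∷ (# 3 , # 4) ∷ []) ∷
  ((# 5 , # 7) ∷ (# 7 , # 1) ∷ (# 1 , # 3) ∷ (# 3 , # 5) ∷ []) ∷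
  ((# 5 , # 6) ∷ (# 7 , # 2) ∷ (# 1 , # 2) ∷ (# 3 , # 6) ∷ []) ∷
  ((# 5 , # 5) ∷ (# 7 , # 3) ∷ (# 1 , # 1) ∷ (# 3 , # 7) ∷ []) ∷
  []

table : Table
table c k j = lookup (lookup (tables c) k) j

template : IsTemplate table
template = record
  { row-sum               = toWitness {a? = all-Signed? λ _ → all? λ _ → ≟-× _ 0₈} _
  ; zero-and-units-cancel = toWitness {a? = all? λ _ → all? λ _ → ≟-× _ 0₈} _
  ; opposites-cancel      = toWitness {a? = all? λ _ → all? λ _ → ≟-× _ 0₈} _
  ; fibre-bijective       = toWitness {a? = all-Signed? λ c → bijective? (fibre table c)} _
  }

odd⇒≡1+double : ∀ p → p % 2 ≡ 1 → p ≢ 1 → ∃ λ m → p ≡ suc (double (suc m))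
odd⇒≡1+double p odd p≢1 with p / 2 | m≡m%n+[m/n]*n p 2
... | zero  | p≡r+q*2 = ⊥-elim (p≢1 (trans p≡r+q*2 (cong (ℕ._+ 0) odd)))
... | suc m | p≡r+q*2 = m , trans p≡r+q*2 (cong₂ ℕ._+_ odd (sym (double≡n*2 (suc m))))

lemma4p6 : (p : ℕ) .{{_ : NonZero p}} → Prime p → p % 2 ≡ 1 → MRS* p p 4 16
lemma4p6 p p-prime odd with odd⇒≡1+double p odd (λ { refl → ¬prime[1] p-prime })
... | m , refl = Construction.mrs template m
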